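{- For every integer $t\geq 4$, every (finite, simple) graph with no dominating $K_t$-model is $3\cdot 2^{t-4}$-colourable.
   Context: A dominating $K_t$-model in a graph $G$ is a sequence $(T_1,\dots,T_t)$ of pairwise disjoint non-empty connected subgraphs of $G$ such that for all $1\le i<j\le t$, every vertex of $T_j$ has a neighbour in $T_i$. -}

module Defs where

open import Data.Nat using (ℕ)
open import Data.Bool using (Bool; true; false)
open import Data.Fin using (Fin; _<_)
open import Data.Product using (Σ; _×_; ∃)
open import Data.Empty using (⊥)
open import Relation.Binary.PropositionalEquality using (_≡_; _≢_)

record Graph (n : ℕ) : Set where
  field
    adj    : Fin n → Fin n → Bool
    sym    : ∀ u v → adj u v ≡ adj v u
    irrefl : ∀ v → adj v v ≡ false
open Graph public

Adj : ∀ {n} → Graph n → Fin n → Fin n → Set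
Adj G u v = adj G u v ≡ true

VSet : ℕ → Set
VSet n = Fin n → Bool

_∈ˢ_ : ∀ {n} → Fin n → VSet n → Set
v ∈ˢ S = S v ≡ true

data WalkIn {n : ℕ} (G : Graph n) (S : VSet n) : Fin n → Fin n → Set where
  here : ∀ {v} → v ∈ˢ S → WalkIn G S v v
  step : ∀ {u w v} → u ∈ˢ S → Adj G u w → WalkIn G S w v → WalkIn G S u v

NonEmpty : ∀ {n} → VSet n → Set
NonEmpty S = ∃ λ v → v ∈ˢ S

Connected : ∀ {n} → Graph n → VSet n → Set
Connected G S = ∀ u v → u ∈ˢ S → v ∈ˢ S → WalkIn G S u v

record DominatingModel {n : ℕ} (G : Graph n) (t : ℕ) : Set where
  field
    T          : Fin t → VSet n
    nonEmpty   : ∀ i → NonEmpty (T i)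
    connected  : ∀ i → Connected G (T i)
    disjoint   : ∀ i j → i ≢ j → ∀ v → v ∈ˢ T i → v ∈ˢ T j → ⊥
    dominating : ∀ i j → i < j → ∀ v → v ∈ˢ T j →
                 ∃ λ u → u ∈ˢ T i × Adj G u v

Colourable : ∀ {n} → Graph n → ℕ → Set
Colourable {n} G k = Σ (Fin n → Fin k) λ c → ∀ u v → Adj G u v → c u ≢ c v

{-# OPTIONS --safe #-}
module Submission where

-- A graph of minimum degree at least 3 contains a dominating K₄-model, so a graph without one is
-- 2-degenerate and greedily 3-colourable. To find the model, keep a connected set X and a set C of
-- other vertices that still has a 2-core, and shrink C as long as possible: move a neighbour of X from
-- C into X when C keeps a 2-core, or restart from a single vertex of C when no vertex of C is adjacent
-- to X. Once C cannot shrink, counting degrees shows that every vertex of C is adjacent to X, so X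
-- together with a dominating K₃-model in the 2-core of C (found by the same argument one level down,
-- where C keeps an edge) is a dominating K₄-model.
-- For the induction step, colour each component layer by layer from a root. The earlier layers form a
-- connected set dominating the next layer, so without a dominating K_{t+1}-model no layer has a
-- dominating K_t-model and the layers can be coloured by induction. Edges only join a layer to itself
-- or to the next one, so alternating between two copies of the palette gives a proper colouring.

open import Defs hiding (sym)
open import Algebra.Properties.CommutativeSemigroup using (x∙yz≈y∙xz)
open import Data.Bool using (Bool; true; false; not; _∧_; _∨_; if_then_else_)
open import Data.Bool.Properties using (∧-assoc; ∧-conicalˡ; ∧-conicalʳ; ∨-zeroʳ; ¬-not; not-¬)
  renaming (_≟_ to _≟ᵇ_)
open import Data.Empty using (⊥; ⊥-elim)
open import Data.Fin using (Fin; zero; suc; combine) renaming (_<_ to _<ᶠ_)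
open import Data.Fin.Properties
  using (_≟_; any?; all?; ¬∀⟶∃¬; 0≢1+n; suc-injective; combine-injective)
open import Data.Nat using (ℕ; zero; suc; _+_; _*_; _^_; _∸_; _≤_; _<_; _<?_; z≤n; s≤s)
open import Data.Nat.Induction using (<-wellFounded)
open import Data.Nat.Properties
  using ( ≤-refl; ≤-reflexive; ≤-trans; ≤-<-trans; ≤-pred; n≤1+n; n<1+n; n≤0⇒n≡0; <⇒≱; ≮⇒≥
        ; m+1+n≰m; +-comm; +-identityʳ; *-identityʳ; *-zeroʳ; *-suc; +-mono-≤; +-monoˡ-≤
        ; *-monoʳ-≤; *-monoˡ-≤; +-cancelˡ-≤; +-*-semiring; +-commutativeSemigroup
        ; *-commutativeSemigroup; module ≤-Reasoning )
open import Data.Nat.Solver using (module +-*-Solver)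
open import Data.Product using (Σ; _×_; _,_; ∃; proj₁; proj₂)
open import Data.Product.Properties using (,-injectiveʳ)
open import Data.Sum using (_⊎_; inj₁; inj₂)
open import Data.Vec.Functional using (_∷_; updateAt)
open import Data.Vec.Functional.Properties using (updateAt-updates; updateAt-minimal)
open import Function using (_∘_; id)
open import Function.Definitions using (Injective)
open import Induction.WellFounded using (Acc; acc)
open import Relation.Binary.PropositionalEquality
  using (_≡_; _≢_; refl; sym; trans; cong; cong₂; subst; subst₂; module ≡-Reasoning)
open import Relation.Nullary using (¬_; Dec; yes; no; does; contradiction; _×-dec_)
open import Relation.Nullary.Decidable using (map′; dec-true; dec-false)

open import Algebra.Properties.Semiring.Sum +-*-semiring
  using (sum; sum-cong-≗; sum-replicate-zero; ∑-distrib-+; *-distribˡ-sum)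
open +-*-Solver using (solve; _:+_; _:*_; _:=_; con)

module _ {n : ℕ} where

  infix  4 _⊆_
  infixr 22 _∩_
  infixr 21 _∪_ _∖_
  infixl 23 _─_

  _⊆_ : VSet n → VSet n → Set
  S ⊆ T = ∀ v → v ∈ˢ S → v ∈ˢ T

  Disjoint : VSet n → VSet n → Set
  Disjoint S T = ∀ v → v ∈ˢ S → v ∈ˢ T → ⊥

  Empty : VSet n → Set
  Empty S = ∀ v → S v ≡ false

  ∅ : VSet n
  ∅ _ = false

  nonEmpty? : (S : VSet n) → Dec (NonEmpty S)
  nonEmpty? S = any? (λ v → S v ≟ᵇ true)

  ¬nonEmpty⇒empty : ∀ {S} → ¬ NonEmpty S → Empty S
  ¬nonEmpty⇒empty ¬ne v = ¬-not (λ v∈S → ¬ne (v , v∈S))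

  ∉-≢ : ∀ (S : VSet n) {u v} → S u ≡ false → v ∈ˢ S → u ≢ v
  ∉-≢ _ u∉S v∈S refl = contradiction (trans (sym v∈S) u∉S) λ ()

  ⊆-∉ : ∀ {S T v} → S ⊆ T → T v ≡ false → S v ≡ false
  ⊆-∉ {T = T} {v} S⊆T v∉T = ¬-not (λ v∈S → ∉-≢ T v∉T (S⊆T v v∈S) refl)

  -- Opaque, so that a membership goal determines the sets it mentions. (S ∖ T) v tests T first,
  -- so that S ─ a computes on the constructors of Fin (see sumOn-─).
  opaque
    ⁅_⁆ : Fin n → VSet n
    ⁅ a ⁆ v = does (v ≟ a)

    _∪_ _∩_ _∖_ : VSet n → VSet n → VSet n
    (S ∪ T) v = S v ∨ T v
    (S ∩ T) v = S v ∧ T v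
    (S ∖ T) v = not (T v) ∧ S v

  _─_ : VSet n → Fin n → VSet n
  S ─ a = S ∖ ⁅ a ⁆

  opaque
    unfolding ⁅_⁆

    ∈-⁅⁆ : ∀ {a} → a ∈ˢ ⁅ a ⁆
    ∈-⁅⁆ {a} = dec-true (a ≟ a) refl

    ∈-⁅⁆⁻ : ∀ {a v} → v ∈ˢ ⁅ a ⁆ → v ≡ a
    ∈-⁅⁆⁻ {a} {v} v∈ with v ≟ a
    ... | yes v≡a = v≡a

    ∉-⁅⁆ : ∀ {a v} → v ≢ a → ⁅ a ⁆ v ≡ false
    ∉-⁅⁆ {a} {v} = dec-false (v ≟ a)

  opaque
    unfolding _∪_

    ∈-∪⁺ˡ : ∀ {S T v} → v ∈ˢ S → v ∈ˢ S ∪ T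
    ∈-∪⁺ˡ v∈S rewrite v∈S = refl

    ∈-∪⁺ʳ : ∀ {S T v} → v ∈ˢ T → v ∈ˢ S ∪ T
    ∈-∪⁺ʳ {S} {v = v} v∈T rewrite v∈T = ∨-zeroʳ (S v)

    ∈-∪⁻ : ∀ {S T v} → v ∈ˢ S ∪ T → v ∈ˢ S ⊎ v ∈ˢ T
    ∈-∪⁻ {S} {v = v} v∈ with S v
    ... | true  = inj₁ refl
    ... | false = inj₂ v∈

  opaque
    unfolding _∩_

    ∈-∩⁺ : ∀ {S T v} → v ∈ˢ S → v ∈ˢ T → v ∈ˢ S ∩ T
    ∈-∩⁺ v∈S v∈T rewrite v∈S | v∈T = refl

    ∈-∩⁻ˡ : ∀ {S T v} → v ∈ˢ S ∩ T → v ∈ˢ S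
    ∈-∩⁻ˡ {S} {T} {v} = ∧-conicalˡ (S v) (T v)

    ∈-∩⁻ʳ : ∀ {S T v} → v ∈ˢ S ∩ T → v ∈ˢ T
    ∈-∩⁻ʳ {S} {T} {v} = ∧-conicalʳ (S v) (T v)

  opaque
    unfolding _∖_

    ∈-∖⁺ : ∀ {S T v} → v ∈ˢ S → T v ≡ false → v ∈ˢ S ∖ T
    ∈-∖⁺ v∈S v∉T rewrite v∈S | v∉T = refl

    ∈-∖⁻ˡ : ∀ {S T v} → v ∈ˢ S ∖ T → v ∈ˢ S
    ∈-∖⁻ˡ {S} {T} {v} = ∧-conicalʳ (not (T v)) (S v)

    ∈-∖⁻ʳ : ∀ {S T v} → v ∈ˢ S ∖ T → T v ≡ false
    ∈-∖⁻ʳ {S} {T} {v} v∈ with T v | ∧-conicalˡ (not (T v)) (S v) v∈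
    ... | false | _ = refl

  ∈-─⁺ : ∀ {S a v} → v ∈ˢ S → v ≢ a → v ∈ˢ S ─ a
  ∈-─⁺ v∈S v≢a = ∈-∖⁺ v∈S (∉-⁅⁆ v≢a)

  ∈-─⁻ʳ : ∀ {S a v} → v ∈ˢ S ─ a → v ≢ a
  ∈-─⁻ʳ {a = a} v∈ refl = ∉-≢ ⁅ a ⁆ (∈-∖⁻ʳ v∈) ∈-⁅⁆ refl

  ─-⊆ : ∀ {S a} → S ─ a ⊆ S
  ─-⊆ _ = ∈-∖⁻ˡ

  ⁅⁆-⊆ : ∀ {S a} → a ∈ˢ S → ⁅ a ⁆ ⊆ S
  ⁅⁆-⊆ {S} a∈S v v∈ = subst (_∈ˢ S) (sym (∈-⁅⁆⁻ v∈)) a∈S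

  ∪-⊆ : ∀ {S T U} → S ⊆ U → T ⊆ U → S ∪ T ⊆ U
  ∪-⊆ S⊆U T⊆U v v∈ with ∈-∪⁻ v∈
  ... | inj₁ v∈S = S⊆U v v∈S
  ... | inj₂ v∈T = T⊆U v v∈T

  argmin : ∀ (S : VSet n) (f : Fin n → ℕ) → NonEmpty S →
           ∃ λ a → a ∈ˢ S × (∀ b → b ∈ˢ S → f a ≤ f b)
  argmin S f (a , a∈S) = go a a∈S (<-wellFounded (f a))
    where
    go : ∀ a → a ∈ˢ S → Acc _<_ (f a) → ∃ λ a → a ∈ˢ S × (∀ b → b ∈ˢ S → f a ≤ f b)
    go a a∈S (acc rec) with any? (λ b → (S b ≟ᵇ true) ×-dec (f b <? f a))
    ... | yes (b , b∈S , fb<fa) = go b b∈S (rec fb<fa)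
    ... | no ¬smaller = a , a∈S , λ b b∈S → ≮⇒≥ (λ fb<fa → ¬smaller (b , b∈S , fb<fa))

  opaque
    unfolding _∩_ _∖_

    ∩-─ : ∀ (S P : VSet n) a v → ((S ∩ P) ─ a) v ≡ ((S ─ a) ∩ P) v
    ∩-─ S P a v = sym (∧-assoc (not (⁅ a ⁆ v)) (S v) (P v))

    ∩-∈ˡ : ∀ {S P : VSet n} {v} → v ∈ˢ S → (S ∩ P) v ≡ P v
    ∩-∈ˡ v∈S rewrite v∈S = refl

sumOn : ∀ {n} → VSet n → (Fin n → ℕ) → ℕ
sumOn S g = sum (λ v → if S v then g v else 0)

count : ∀ {n} → VSet n → ℕ
count S = sumOn S (λ _ → 1)

sum-mono-≤ : ∀ {n} {f g : Fin n → ℕ} → (∀ i → f i ≤ g i) → sum f ≤ sum g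
sum-mono-≤ {zero}  _   = z≤n
sum-mono-≤ {suc n} f≤g = +-mono-≤ (f≤g zero) (sum-mono-≤ (f≤g ∘ suc))

opaque
  unfolding _∖_ ⁅_⁆

  sumOn-─ : ∀ {n} (S : VSet n) (g : Fin n → ℕ) a →
            sumOn S g ≡ (if S a then g a else 0) + sumOn (S ─ a) g
  sumOn-─ S g zero    = refl
  sumOn-─ S g (suc a) =
    trans (cong (s₀ +_) (sumOn-─ (S ∘ suc) (g ∘ suc) a))
          (x∙yz≈y∙xz +-commutativeSemigroup s₀ (if S (suc a) then g (suc a) else 0) _)
    where
    s₀ : ℕ
    s₀ = if S zero then g zero else 0

module _ {n : ℕ} where

  sumOn-cong : ∀ {S : VSet n} {g h} → (∀ v → v ∈ˢ S → g v ≡ h v) → sumOn S g ≡ sumOn S h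
  sumOn-cong {S} {g} {h} g≡h = sum-cong-≗ pointwise
    where
    pointwise : ∀ v → (if S v then g v else 0) ≡ (if S v then h v else 0)
    pointwise v with S v in v∈S
    ... | true  = g≡h v v∈S
    ... | false = refl

  sumOn-≗ : ∀ {S T : VSet n} {g} → (∀ v → S v ≡ T v) → sumOn S g ≡ sumOn T g
  sumOn-≗ {g = g} S≗T = sum-cong-≗ (λ v → cong (λ b → if b then g v else 0) (S≗T v))

  sumOn-mono : ∀ {S : VSet n} {g h} → (∀ v → v ∈ˢ S → g v ≤ h v) → sumOn S g ≤ sumOn S h
  sumOn-mono {S} {g} {h} g≤h = sum-mono-≤ pointwise
    where
    pointwise : ∀ v → (if S v then g v else 0) ≤ (if S v then h v else 0)
    pointwise v with S v in v∈S
    ... | true  = g≤h v v∈S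
    ... | false = z≤n

  sumOn-⊆ : ∀ {S T : VSet n} {g} → S ⊆ T → sumOn S g ≤ sumOn T g
  sumOn-⊆ {S} {T} {g} S⊆T = sum-mono-≤ pointwise
    where
    pointwise : ∀ v → (if S v then g v else 0) ≤ (if T v then g v else 0)
    pointwise v with S v in v∈S
    ... | false = z≤n
    ... | true rewrite S⊆T v v∈S = ≤-refl

  sumOn-empty : ∀ {S : VSet n} {g} → Empty S → sumOn S g ≡ 0
  sumOn-empty {g = g} empty =
    trans (sum-cong-≗ (λ v → cong (λ b → if b then g v else 0) (empty v))) (sum-replicate-zero n)

  sumOn-+ : ∀ (S : VSet n) g h → sumOn S (λ v → g v + h v) ≡ sumOn S g + sumOn S h
  sumOn-+ S g h = trans (sum-cong-≗ pointwise)
    (∑-distrib-+ (λ v → if S v then g v else 0) (λ v → if S v then h v else 0))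
    where
    pointwise : ∀ v → (if S v then g v + h v else 0) ≡ (if S v then g v else 0) + (if S v then h v else 0)
    pointwise v with S v
    ... | true  = refl
    ... | false = refl

  sumOn-const : ∀ (S : VSet n) k → sumOn S (λ _ → k) ≡ k * count S
  sumOn-const S k = trans (sum-cong-≗ pointwise) (sym (*-distribˡ-sum k (λ v → if S v then 1 else 0)))
    where
    pointwise : ∀ v → (if S v then k else 0) ≡ k * (if S v then 1 else 0)
    pointwise v with S v
    ... | true  = sym (*-identityʳ k)
    ... | false = sym (*-zeroʳ k)

  opaque
    unfolding _∩_ _∖_

    sumOn-partition : ∀ (S P : VSet n) g → sumOn S g ≡ sumOn (S ∩ P) g + sumOn (S ∖ P) g
    sumOn-partition S P g = trans (sum-cong-≗ pointwise)
      (∑-distrib-+ (λ v → if S v ∧ P v then g v else 0) (λ v → if not (P v) ∧ S v then g v else 0))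
      where
      pointwise : ∀ v → (if S v then g v else 0) ≡
                        (if S v ∧ P v then g v else 0) + (if not (P v) ∧ S v then g v else 0)
      pointwise v with S v | P v
      ... | true  | true  = sym (+-identityʳ _)
      ... | true  | false = refl
      ... | false | true  = refl
      ... | false | false = refl

    sumOn-∩ : ∀ (S P : VSet n) g → sumOn (S ∩ P) g ≡ sumOn S (λ v → if P v then g v else 0)
    sumOn-∩ S P g = sum-cong-≗ pointwise
      where
      pointwise : ∀ v → (if S v ∧ P v then g v else 0) ≡ (if S v then (if P v then g v else 0) else 0)
      pointwise v with S v
      ... | true  = refl
      ... | false = refl

  sumOn-remove : ∀ {S : VSet n} {a} g → a ∈ˢ S → sumOn S g ≡ g a + sumOn (S ─ a) g
  sumOn-remove {S} {a} g a∈S =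
    trans (sumOn-─ S g a) (cong (λ b → (if b then g a else 0) + sumOn (S ─ a) g) a∈S)

  count-remove : ∀ {S : VSet n} {a} → a ∈ˢ S → count S ≡ suc (count (S ─ a))
  count-remove = sumOn-remove (λ _ → 1)

  count-pos : ∀ {S : VSet n} {a} → a ∈ˢ S → 1 ≤ count S
  count-pos {S} a∈S = subst (1 ≤_) (sym (count-remove {S} a∈S)) (s≤s z≤n)

  count-pos⁻¹ : ∀ {S : VSet n} → 1 ≤ count S → NonEmpty S
  count-pos⁻¹ {S} 1≤count with nonEmpty? S
  ... | yes ne = ne
  ... | no ¬ne = ⊥-elim (<⇒≱ 1≤count (≤-reflexive (sumOn-empty (¬nonEmpty⇒empty ¬ne))))

  count-∖< : ∀ {S T : VSet n} {a} → a ∈ˢ S ∩ T → count (S ∖ T) < count S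
  count-∖< {S} {T} {a} a∈ = begin-strict
    count (S ∖ T)      ≤⟨ sumOn-⊆ S∖T⊆S─a ⟩
    count (S ─ a)      <⟨ n<1+n _ ⟩
    suc (count (S ─ a)) ≡⟨ sym (count-remove (∈-∩⁻ˡ a∈)) ⟩
    count S            ∎
    where
    open ≤-Reasoning
    S∖T⊆S─a : S ∖ T ⊆ S ─ a
    S∖T⊆S─a v v∈ = ∈-─⁺ (∈-∖⁻ˡ v∈) (∉-≢ T (∈-∖⁻ʳ v∈) (∈-∩⁻ʳ a∈))

  count-─< : ∀ {S : VSet n} {a} → a ∈ˢ S → count (S ─ a) < count S
  count-─< a∈S = count-∖< (∈-∩⁺ a∈S ∈-⁅⁆)

  injection⇒≤count : ∀ {m} {S : VSet n} (f : Fin m → Fin n) →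
                     Injective _≡_ _≡_ f → (∀ i → f i ∈ˢ S) → m ≤ count S
  injection⇒≤count {zero}  f _ _ = z≤n
  injection⇒≤count {suc m} {S} f f-inj f∈S = begin
    suc m                      ≤⟨ s≤s (injection⇒≤count (f ∘ suc) (suc-injective ∘ f-inj) f∘suc∈) ⟩
    suc (count (S ─ f zero))   ≡⟨ sym (count-remove (f∈S zero)) ⟩
    count S                    ∎
    where
    open ≤-Reasoning
    f∘suc∈ : ∀ i → f (suc i) ∈ˢ S ─ f zero
    f∘suc∈ i = ∈-─⁺ (f∈S (suc i)) (λ eq → 0≢1+n (sym (f-inj eq)))

module _ {n : ℕ} (G : Graph n) where

  adj-sym : ∀ {u v} → Adj G u v → Adj G v u
  adj-sym {u} {v} uv = trans (Graph.sym G v u) uv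

  adj-irrefl : ∀ {u v} → Adj G u v → u ≢ v
  adj-irrefl {u} uv refl = contradiction (trans (sym uv) (irrefl G u)) λ ()

  opaque
    N[_] : VSet n → VSet n
    N[ X ] y = does (nonEmpty? (X ∩ adj G y))

  opaque
    unfolding N[_]

    ∈N⁺ : ∀ {X x y} → x ∈ˢ X → Adj G x y → y ∈ˢ N[ X ]
    ∈N⁺ {X} {x} {y} x∈X xy = dec-true (nonEmpty? (X ∩ adj G y)) (x , ∈-∩⁺ x∈X (adj-sym xy))

    ∈N⁻ : ∀ {X y} → y ∈ˢ N[ X ] → ∃ λ x → x ∈ˢ X × Adj G x y
    ∈N⁻ {X} {y} y∈ with nonEmpty? (X ∩ adj G y)
    ... | yes (x , x∈) = x , ∈-∩⁻ˡ x∈ , adj-sym (∈-∩⁻ʳ x∈)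

  N-mono : ∀ {X Y} → X ⊆ Y → N[ X ] ⊆ N[ Y ]
  N-mono X⊆Y y y∈ with ∈N⁻ y∈
  ... | x , x∈X , xy = ∈N⁺ (X⊆Y x x∈X) xy

  ∉N : ∀ {X x y} → N[ X ] y ≡ false → x ∈ˢ X → adj G x y ≡ false
  ∉N {X} y∉ x∈X = ¬-not (λ xy → ∉-≢ N[ X ] y∉ (∈N⁺ x∈X xy) refl)

  deg : VSet n → Fin n → ℕ
  deg T v = count (T ∩ adj G v)

  degreeSum : VSet n → ℕ
  degreeSum T = sumOn T (deg T)

  deg-remove : ∀ T a v → deg T v ≡ (if (T ∩ adj G v) a then 1 else 0) + deg (T ─ a) v
  deg-remove T a v =
    trans (sumOn-─ (T ∩ adj G v) (λ _ → 1) a)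
          (cong ((if (T ∩ adj G v) a then 1 else 0) +_) (sumOn-≗ (∩-─ T (adj G v) a)))

  deg-remove-≤ : ∀ T a v → deg T v ≤ suc (deg (T ─ a) v)
  deg-remove-≤ T a v rewrite deg-remove T a v with (T ∩ adj G v) a
  ... | true  = ≤-refl
  ... | false = n≤1+n _

  deg-remove-nonadj : ∀ T {a v} → adj G v a ≡ false → deg (T ─ a) v ≡ deg T v
  deg-remove-nonadj T {a} {v} va
    rewrite deg-remove T a v | ⊆-∉ {S = T ∩ adj G v} (λ _ → ∈-∩⁻ʳ) va = refl

  deg-remove-self : ∀ T a → deg (T ─ a) a ≡ deg T a
  deg-remove-self T a = deg-remove-nonadj T (irrefl G a)

  deg-mono : ∀ {K T} v → K ⊆ T → deg K v ≤ deg T v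
  deg-mono v K⊆T = sumOn-⊆ (λ u u∈ → ∈-∩⁺ (K⊆T u (∈-∩⁻ˡ u∈)) (∈-∩⁻ʳ u∈))

  deg≤count-─ : ∀ T v → deg T v ≤ count (T ─ v)
  deg≤count-─ T v = begin
    deg T v       ≡⟨ sym (deg-remove-self T v) ⟩
    deg (T ─ v) v ≤⟨ sumOn-⊆ {S = T ─ v ∩ adj G v} (λ _ → ∈-∩⁻ˡ) ⟩
    count (T ─ v) ∎
    where open ≤-Reasoning

  deg<count : ∀ {T v} → v ∈ˢ T → deg T v < count T
  deg<count {T} {v} v∈T = ≤-<-trans (deg≤count-─ T v) (count-─< {S = T} v∈T)

  deg-pos : ∀ {T v w} → w ∈ˢ T → Adj G v w → 1 ≤ deg T v
  deg-pos {T} {v} w∈T vw = count-pos {S = T ∩ adj G v} (∈-∩⁺ w∈T vw)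

  neighbour : ∀ {T v} → 1 ≤ deg T v → ∃ λ w → w ∈ˢ T × Adj G v w
  neighbour 1≤deg with count-pos⁻¹ 1≤deg
  ... | w , w∈ = w , ∈-∩⁻ˡ w∈ , ∈-∩⁻ʳ w∈

  degreeSum-remove : ∀ {T a} → a ∈ˢ T → degreeSum T ≡ 2 * deg T a + degreeSum (T ─ a)
  degreeSum-remove {T} {a} a∈T = begin
    degreeSum T
      ≡⟨ sumOn-remove (deg T) a∈T ⟩
    d + sumOn (T ─ a) (deg T)
      ≡⟨ cong (d +_) (sumOn-cong {S = T ─ a} λ v _ → trans (deg-remove T a v)
           (cong (λ b → (if b then 1 else 0) + deg (T ─ a) v) (∩-∈ˡ a∈T))) ⟩
    d + sumOn (T ─ a) (λ v → (if adj G v a then 1 else 0) + deg (T ─ a) v)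
      ≡⟨ cong (d +_) (sumOn-+ (T ─ a) _ _) ⟩
    d + (sumOn (T ─ a) (λ v → if adj G v a then 1 else 0) + degreeSum (T ─ a))
      ≡⟨ cong (λ x → d + (x + degreeSum (T ─ a))) edgesToA ⟩
    d + (d + degreeSum (T ─ a))
      ≡⟨ solve 2 (λ d e → d :+ (d :+ e) := con 2 :* d :+ e) refl d (degreeSum (T ─ a)) ⟩
    2 * d + degreeSum (T ─ a)
      ∎
    where
    open ≡-Reasoning
    d : ℕ
    d = deg T a
    edgesToA : sumOn (T ─ a) (λ v → if adj G v a then 1 else 0) ≡ d
    edgesToA = begin
      sumOn (T ─ a) (λ v → if adj G v a then 1 else 0)
        ≡⟨ sumOn-cong {S = T ─ a} (λ v _ → cong (λ b → if b then 1 else 0) (Graph.sym G v a)) ⟩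
      sumOn (T ─ a) (λ v → if adj G a v then 1 else 0)
        ≡⟨ sym (sumOn-∩ (T ─ a) (adj G a) (λ _ → 1)) ⟩
      deg (T ─ a) a
        ≡⟨ deg-remove-self T a ⟩
      d ∎

  walk-mono : ∀ {S S′ u v} → S ⊆ S′ → WalkIn G S u v → WalkIn G S′ u v
  walk-mono S⊆S′ (here v∈)        = here (S⊆S′ _ v∈)
  walk-mono S⊆S′ (step u∈ uw walk) = step (S⊆S′ _ u∈) uw (walk-mono S⊆S′ walk)

  walk-++ : ∀ {S u w v} → WalkIn G S u w → WalkIn G S w v → WalkIn G S u v
  walk-++ (here _)          walk′ = walk′
  walk-++ (step u∈ uw walk) walk′ = step u∈ uw (walk-++ walk walk′)

  connected-∅ : Connected G ∅
  connected-∅ _ _ ()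

  connected-⁅⁆ : ∀ r → Connected G ⁅ r ⁆
  connected-⁅⁆ r u v u∈ v∈ with ∈-⁅⁆⁻ u∈ | ∈-⁅⁆⁻ v∈
  ... | refl | refl = here u∈

  attached-walks : ∀ {X B w} → B ⊆ N[ X ] → w ∈ˢ X ∪ B →
                   ∃ λ x → x ∈ˢ X × WalkIn G (X ∪ B) x w × WalkIn G (X ∪ B) w x
  attached-walks {w = w} B⊆N w∈ with ∈-∪⁻ w∈
  ... | inj₁ w∈X = w , w∈X , here w∈ , here w∈
  ... | inj₂ w∈B with ∈N⁻ (B⊆N w w∈B)
  ...   | x , x∈X , xw =
    x , x∈X , step (∈-∪⁺ˡ x∈X) xw (here w∈) , step w∈ (adj-sym xw) (here (∈-∪⁺ˡ x∈X))

  connected-∪ : ∀ {X B} → Connected G X → B ⊆ N[ X ] → Connected G (X ∪ B)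
  connected-∪ X-conn B⊆N u v u∈ v∈
    with attached-walks B⊆N u∈ | attached-walks B⊆N v∈
  ... | x , x∈X , _ , u→x | y , y∈X , y→v , _ =
    walk-++ u→x (walk-++ (walk-mono (λ _ → ∈-∪⁺ˡ) (X-conn x y x∈X y∈X)) y→v)

  ModelIn : ℕ → VSet n → Set
  ModelIn t S = Σ (DominatingModel G t) λ M → ∀ i → DominatingModel.T M i ⊆ S

  NoModel : ℕ → VSet n → Set
  NoModel t S = ¬ ModelIn t S

  modelIn-mono : ∀ {t S S′} → S ⊆ S′ → ModelIn t S → ModelIn t S′
  modelIn-mono S⊆S′ (M , M⊆S) = M , λ i v v∈ → S⊆S′ v (M⊆S i v v∈)

  noModel-∅ : ∀ {t} → NoModel (suc t) ∅
  noModel-∅ (M , M⊆∅) with DominatingModel.nonEmpty M zero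
  ... | v , v∈ = contradiction (M⊆∅ zero v v∈) λ ()

  singletonModel : ∀ {S v} → v ∈ˢ S → ModelIn 1 S
  singletonModel {v = v} v∈S = model , λ _ → ⁅⁆-⊆ v∈S
    where
    model : DominatingModel G 1
    model = record
      { T          = λ _ → ⁅ v ⁆
      ; nonEmpty   = λ _ → v , ∈-⁅⁆
      ; connected  = λ _ → connected-⁅⁆ v
      ; disjoint   = λ { zero zero 0≢0 → contradiction refl 0≢0 }
      ; dominating = λ { zero zero () }
      }

  extendModel : ∀ {t X A} → NonEmpty X → Connected G X → Disjoint X A → A ⊆ N[ X ] →
                ModelIn t A → ModelIn (suc t) (X ∪ A)
  extendModel {t} {X} {A} X≠∅ X-conn X∩A=∅ A⊆N (M , M⊆A) = model , inside
    where
    open DominatingModel M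
    ne : ∀ i → NonEmpty ((X ∷ T) i)
    ne zero    = X≠∅
    ne (suc i) = nonEmpty i
    conn : ∀ i → Connected G ((X ∷ T) i)
    conn zero    = X-conn
    conn (suc i) = connected i
    disj : ∀ i j → i ≢ j → ∀ v → v ∈ˢ (X ∷ T) i → v ∈ˢ (X ∷ T) j → ⊥
    disj zero    zero    0≢0 = contradiction refl 0≢0
    disj zero    (suc j) _   v v∈X v∈Tj = X∩A=∅ v v∈X (M⊆A j v v∈Tj)
    disj (suc i) zero    _   v v∈Ti v∈X = X∩A=∅ v v∈X (M⊆A i v v∈Ti)
    disj (suc i) (suc j) i≢j = disjoint i j (i≢j ∘ cong suc)
    dom : ∀ i j → i <ᶠ j → ∀ v → v ∈ˢ (X ∷ T) j → ∃ λ u → u ∈ˢ (X ∷ T) i × Adj G u v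
    dom zero    (suc j) _         v v∈Tj = ∈N⁻ (A⊆N v (M⊆A j v v∈Tj))
    dom (suc i) (suc j) (s≤s i<j) = dominating i j i<j
    model : DominatingModel G (suc t)
    model = record { T = X ∷ T ; nonEmpty = ne ; connected = conn ; disjoint = disj ; dominating = dom }
    inside : ∀ i → (X ∷ T) i ⊆ X ∪ A
    inside zero    _ = ∈-∪⁺ˡ
    inside (suc i) v = ∈-∪⁺ʳ ∘ M⊆A i v

  -- Cores

  MinDegree : ℕ → VSet n → Set
  MinDegree d K = ∀ v → v ∈ˢ K → d ≤ deg K v

  HasCore : ℕ → VSet n → Set
  HasCore d T = ∃ λ K → K ⊆ T × NonEmpty K × MinDegree d K

  hasCore-mono : ∀ {d T T′} → T ⊆ T′ → HasCore d T → HasCore d T′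
  hasCore-mono T⊆T′ (K , K⊆T , K≠∅ , minDeg) = K , (λ v → T⊆T′ v ∘ K⊆T v) , K≠∅ , minDeg

  hasCore⇒nonEmpty : ∀ {d T} → HasCore d T → NonEmpty T
  hasCore⇒nonEmpty (K , K⊆T , (v , v∈K) , _) = v , K⊆T v v∈K

  lowVertex? : ∀ d T → (∃ λ v → v ∈ˢ T × deg T v < d) ⊎ MinDegree d T
  lowVertex? d T with any? (λ v → (T v ≟ᵇ true) ×-dec (deg T v <? d))
  ... | yes low = inj₁ low
  ... | no ¬low = inj₂ λ v v∈T → ≮⇒≥ (λ low → ¬low (v , v∈T , low))

  hasCore-─-low : ∀ {d T v} → deg T v < d → HasCore d T → HasCore d (T ─ v)
  hasCore-─-low {T = T} {v} low (K , K⊆T , K≠∅ , minDeg) = K , K⊆T─v , K≠∅ , minDeg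
    where
    K⊆T─v : K ⊆ T ─ v
    K⊆T─v u u∈K = ∈-─⁺ (K⊆T u u∈K) λ { refl → <⇒≱ low (≤-trans (minDeg u u∈K) (deg-mono u K⊆T)) }

  hasCore? : ∀ d T → Dec (HasCore d T)
  hasCore? d T = go T (<-wellFounded (count T))
    where
    go : ∀ T → Acc _<_ (count T) → Dec (HasCore d T)
    go T (acc rec) with lowVertex? d T
    ... | inj₁ (v , v∈T , low) =
      map′ (hasCore-mono ─-⊆) (hasCore-─-low low) (go (T ─ v) (rec (count-─< {S = T} v∈T)))
    ... | inj₂ minDeg =
      map′ (λ T≠∅ → T , (λ _ → id) , T≠∅ , minDeg) hasCore⇒nonEmpty (nonEmpty? T)

  noCore-induction : ∀ d (P : VSet n → Set) →
                     (∀ {T} → Empty T → P T) →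
                     (∀ {T v} → v ∈ˢ T → deg T v < d → P (T ─ v) → P T) →
                     ∀ T → ¬ HasCore d T → P T
  noCore-induction d P base peel T = go T (<-wellFounded (count T))
    where
    go : ∀ T → Acc _<_ (count T) → ¬ HasCore d T → P T
    go T (acc rec) noCore with nonEmpty? T | lowVertex? d T
    ... | no T=∅  | _           = base (¬nonEmpty⇒empty T=∅)
    ... | yes T≠∅ | inj₂ minDeg = contradiction (T , (λ _ → id) , T≠∅ , minDeg) noCore
    ... | yes _   | inj₁ (v , v∈T , low) =
      peel v∈T low (go (T ─ v) (rec (count-─< {S = T} v∈T)) (noCore ∘ hasCore-mono ─-⊆))

  critical-deg : ∀ {d C a} → HasCore d C → ¬ HasCore d (C ─ a) → d ≤ deg C a
  critical-deg {C = C} {a} (K , K⊆C , K≠∅ , minDeg) critical with K a in a∈K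
  ... | true  = ≤-trans (minDeg a a∈K) (deg-mono a K⊆C)
  ... | false = contradiction (K , K⊆C─a , K≠∅ , minDeg) critical
    where
    K⊆C─a : K ⊆ C ─ a
    K⊆C─a v v∈K = ∈-─⁺ (K⊆C v v∈K) (∉-≢ K a∈K v∈K ∘ sym)

  edge⇒core₁ : ∀ {T u w} → u ∈ˢ T → w ∈ˢ T → Adj G u w → HasCore 1 T
  edge⇒core₁ {u = u} {w} u∈T w∈T uw =
    ⁅ u ⁆ ∪ ⁅ w ⁆ , ∪-⊆ (⁅⁆-⊆ u∈T) (⁅⁆-⊆ w∈T) , (u , ∈-∪⁺ˡ ∈-⁅⁆) , minDeg
    where
    minDeg : MinDegree 1 (⁅ u ⁆ ∪ ⁅ w ⁆)
    minDeg v v∈ with ∈-∪⁻ v∈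
    ... | inj₁ v∈u rewrite ∈-⁅⁆⁻ v∈u = deg-pos (∈-∪⁺ʳ ∈-⁅⁆) uw
    ... | inj₂ v∈w rewrite ∈-⁅⁆⁻ v∈w = deg-pos (∈-∪⁺ˡ ∈-⁅⁆) (adj-sym uw)

  degreeSum-forest : ∀ T → ¬ HasCore 2 T → ∀ {v} → v ∈ˢ T → degreeSum T + 2 ≤ 2 * count T
  degreeSum-forest = noCore-induction 2 P (λ {T} T=∅ {v} v∈T → ⊥-elim (∉-≢ T (T=∅ v) v∈T refl)) peel
    where
    P : VSet n → Set
    P T = ∀ {v} → v ∈ˢ T → degreeSum T + 2 ≤ 2 * count T
    peel : ∀ {T v} → v ∈ˢ T → deg T v < 2 → P (T ─ v) → P T
    peel {T} {v} v∈T low IH _ = begin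
      degreeSum T + 2                     ≡⟨ cong (_+ 2) (degreeSum-remove v∈T) ⟩
      2 * deg T v + degreeSum (T ─ v) + 2 ≤⟨ +-monoˡ-≤ 2 rest ⟩
      2 * count (T ─ v) + 2               ≡⟨ trans (+-comm _ 2) (sym (*-suc 2 _)) ⟩
      2 * suc (count (T ─ v))             ≡⟨ cong (2 *_) (sym (count-remove {S = T} v∈T)) ⟩
      2 * count T                         ∎
      where
      open ≤-Reasoning
      rest : 2 * deg T v + degreeSum (T ─ v) ≤ 2 * count (T ─ v)
      rest with nonEmpty? (T ─ v)
      ... | yes (w , w∈) = begin
        2 * deg T v + degreeSum (T ─ v) ≤⟨ +-monoˡ-≤ _ (*-monoʳ-≤ 2 (≤-pred low)) ⟩
        2 + degreeSum (T ─ v)           ≡⟨ +-comm 2 _ ⟩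
        degreeSum (T ─ v) + 2           ≤⟨ IH w∈ ⟩
        2 * count (T ─ v)               ∎
      ... | no T─v=∅ = begin
        2 * deg T v + degreeSum (T ─ v) ≡⟨ cong₂ (λ d e → 2 * d + e) deg≡0 (sumOn-empty T─v-empty) ⟩
        0                               ≤⟨ z≤n ⟩
        2 * count (T ─ v)               ∎
        where
        T─v-empty : Empty (T ─ v)
        T─v-empty = ¬nonEmpty⇒empty T─v=∅
        deg≡0 : deg T v ≡ 0
        deg≡0 = n≤0⇒n≡0 (≤-trans (deg≤count-─ T v) (≤-reflexive (sumOn-empty T─v-empty)))

  -- Dominating models from cores

  -- The only step of the search in frame-settle that depends on d; it holds for d ≤ 2.
  CriticalCover : ℕ → Set
  CriticalCover d = ∀ C A → HasCore d C → NonEmpty (C ∩ A) →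
                    (∀ v → v ∈ˢ C → A v ≡ false → suc d ≤ deg C v) →
                    (∀ a → a ∈ˢ C ∩ A → ¬ HasCore d (C ─ a)) → C ⊆ A

  criticalCover₀ : CriticalCover 0
  criticalCover₀ C A _ (a , a∈) _ critical y y∈C = ¬-not λ y∉A →
    critical a a∈ (C ─ a , (λ _ → id) , (y , ∈-─⁺ y∈C (∉-≢ A y∉A (∈-∩⁻ʳ a∈))) , λ _ _ → z≤n)

  criticalCover₁ : CriticalCover 1
  criticalCover₁ C A _ (a , a∈) far critical y y∈C = ¬-not λ y∉A →
    let (w , w∈ , yw) = neighbour (≤-pred (≤-trans (far y y∈C y∉A) (deg-remove-≤ C a y)))
    in critical a a∈ (edge⇒core₁ (∈-─⁺ y∈C (∉-≢ A y∉A (∈-∩⁻ʳ a∈))) w∈ yw)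

  -- In criticalCover₂ below, α = |C ∩ A|, β = |C ∖ A| and δ is the least degree in C over C ∩ A.
  counting-contradiction : ∀ α β δ → δ * α + 3 * β + 4 ≤ 2 * (α + β) + 2 * δ →
                           2 ≤ δ → suc δ ≤ α + β → 1 ≤ α → 1 ≤ β → ⊥
  counting-contradiction (suc zero) β δ bound _ δ<1+β _ _ =
    m+1+n≰m β (≤-trans β+2≤δ (≤-pred δ<1+β))
    where
    β+2≤δ : β + 2 ≤ δ
    β+2≤δ = +-cancelˡ-≤ (δ + 2 * β + 2) _ _ (subst₂ _≤_
      (solve 2 (λ β δ → δ :* con 1 :+ con 3 :* β :+ con 4
                      := (δ :+ con 2 :* β :+ con 2) :+ (β :+ con 2)) refl β δ)
      (solve 2 (λ β δ → con 2 :* (con 1 :+ β) :+ con 2 :* δ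
                      := (δ :+ con 2 :* β :+ con 2) :+ δ) refl β δ)
      bound)
  counting-contradiction (suc (suc α)) β δ bound 2≤δ _ _ 1≤β = <⇒≱ 1≤β β≤0
    where
    δα+β≤2α : δ * α + β ≤ 2 * α
    δα+β≤2α = +-cancelˡ-≤ (2 * δ + 2 * β + 4) _ _ (subst₂ _≤_
      (solve 3 (λ α β δ → δ :* (con 2 :+ α) :+ con 3 :* β :+ con 4
                        := (con 2 :* δ :+ con 2 :* β :+ con 4) :+ (δ :* α :+ β)) refl α β δ)
      (solve 3 (λ α β δ → con 2 :* (con 2 :+ α :+ β) :+ con 2 :* δ
                        := (con 2 :* δ :+ con 2 :* β :+ con 4) :+ con 2 :* α) refl α β δ)
      bound)
    β≤0 : β ≤ 0
    β≤0 = +-cancelˡ-≤ (2 * α) β 0 (begin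
      2 * α + β ≤⟨ +-monoˡ-≤ β (*-monoˡ-≤ α 2≤δ) ⟩
      δ * α + β ≤⟨ δα+β≤2α ⟩
      2 * α     ≡⟨ sym (+-identityʳ _) ⟩
      2 * α + 0 ∎)
      where open ≤-Reasoning

  degreeSum-critical : ∀ {C a v} → a ∈ˢ C → ¬ HasCore 2 (C ─ a) → v ∈ˢ C ─ a →
                       degreeSum C + 4 ≤ 2 * count C + 2 * deg C a
  degreeSum-critical {C} {a} a∈C critical v∈ = begin
    degreeSum C + 4
      ≡⟨ cong (_+ 4) (degreeSum-remove a∈C) ⟩
    2 * d + degreeSum (C ─ a) + 4
      ≡⟨ solve 2 (λ d e → con 2 :* d :+ e :+ con 4 := (e :+ con 2) :+ (con 2 :+ con 2 :* d))
                 refl d (degreeSum (C ─ a)) ⟩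
    degreeSum (C ─ a) + 2 + (2 + 2 * d)
      ≤⟨ +-monoˡ-≤ _ (degreeSum-forest (C ─ a) critical v∈) ⟩
    2 * count (C ─ a) + (2 + 2 * d)
      ≡⟨ solve 2 (λ c d → con 2 :* c :+ (con 2 :+ con 2 :* d) := con 2 :* (con 1 :+ c) :+ con 2 :* d)
                 refl (count (C ─ a)) d ⟩
    2 * suc (count (C ─ a)) + 2 * d
      ≡⟨ cong (λ c → 2 * c + 2 * d) (sym (count-remove {S = C} a∈C)) ⟩
    2 * count C + 2 * d
      ∎
    where
    open ≤-Reasoning
    d : ℕ
    d = deg C a

  criticalCover₂ : CriticalCover 2
  criticalCover₂ C A core C∩A≠∅ far critical y y∈C = ¬-not λ y∉A → noFarVertex (∈-∖⁺ y∈C y∉A)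
    where
    noFarVertex : ∀ {y} → y ∈ˢ C ∖ A → ⊥
    noFarVertex {y} y∈ with argmin (C ∩ A) (deg C) C∩A≠∅
    ... | a , a∈ , a-min = counting-contradiction α β δ bound (critical-deg core (critical a a∈))
                             δ<α+β (count-pos {S = C ∩ A} a∈) (count-pos {S = C ∖ A} y∈)
      where
      δ α β : ℕ
      δ = deg C a
      α = count (C ∩ A)
      β = count (C ∖ A)
      |C|≡α+β : count C ≡ α + β
      |C|≡α+β = sumOn-partition C A (λ _ → 1)
      δ<α+β : suc δ ≤ α + β
      δ<α+β = subst (suc δ ≤_) |C|≡α+β (deg<count (∈-∩⁻ˡ a∈))
      y∈C─a : y ∈ˢ C ─ a
      y∈C─a = ∈-─⁺ (∈-∖⁻ˡ y∈) (∉-≢ A (∈-∖⁻ʳ y∈) (∈-∩⁻ʳ a∈))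
      bound : δ * α + 3 * β + 4 ≤ 2 * (α + β) + 2 * δ
      bound = begin
        δ * α + 3 * β + 4
          ≡⟨ cong₂ (λ x y → x + y + 4) (sym (sumOn-const (C ∩ A) δ)) (sym (sumOn-const (C ∖ A) 3)) ⟩
        sumOn (C ∩ A) (λ _ → δ) + sumOn (C ∖ A) (λ _ → 3) + 4
          ≤⟨ +-monoˡ-≤ 4 (+-mono-≤ (sumOn-mono {S = C ∩ A} a-min)
                                    (sumOn-mono {S = C ∖ A} λ v v∈ → far v (∈-∖⁻ˡ v∈) (∈-∖⁻ʳ v∈))) ⟩
        sumOn (C ∩ A) (deg C) + sumOn (C ∖ A) (deg C) + 4
          ≡⟨ cong (_+ 4) (sym (sumOn-partition C A (deg C))) ⟩
        degreeSum C + 4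
          ≤⟨ degreeSum-critical (∈-∩⁻ˡ a∈) (critical a a∈) y∈C─a ⟩
        2 * count C + 2 * δ
          ≡⟨ cong (λ c → 2 * c + 2 * δ) |C|≡α+β ⟩
        2 * (α + β) + 2 * δ
          ∎
        where open ≤-Reasoning

  -- X is the first branch set of the model being built inside S; the others come from a d-core of C
  -- once C ⊆ N[ X ].
  record Frame (d : ℕ) (S X C : VSet n) : Set where
    field
      X⊆S     : X ⊆ S
      C⊆S     : C ⊆ S
      X≠∅     : NonEmpty X
      X-conn  : Connected G X
      X∩C=∅   : Disjoint X C
      C-core  : HasCore d C
      far-deg : ∀ v → v ∈ˢ C → N[ X ] v ≡ false → suc d ≤ deg C v

  frame-restart : ∀ {d S C u} → C ⊆ S → MinDegree (suc d) C → u ∈ˢ C → Frame d S ⁅ u ⁆ (C ─ u)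
  frame-restart {d} {C = C} {u} C⊆S minDeg u∈C = record
    { X⊆S     = ⁅⁆-⊆ (C⊆S u u∈C)
    ; C⊆S     = λ v → C⊆S v ∘ ─-⊆ v
    ; X≠∅     = u , ∈-⁅⁆
    ; X-conn  = connected-⁅⁆ u
    ; X∩C=∅   = λ v v∈u v∈C─u → ∈-─⁻ʳ v∈C─u (∈-⁅⁆⁻ v∈u)
    ; C-core  = C ─ u , (λ _ → id) , C─u≠∅ , λ v v∈ →
                  ≤-pred (≤-trans (minDeg v (─-⊆ v v∈)) (deg-remove-≤ C u v))
    ; far-deg = λ v v∈ v∉N →
                  subst (suc d ≤_) (sym (deg-remove-nonadj C (trans (Graph.sym G v u) (∉N v∉N ∈-⁅⁆))))
                        (minDeg v (─-⊆ v v∈))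
    }
    where
    C─u≠∅ : NonEmpty (C ─ u)
    C─u≠∅ with neighbour (≤-trans (s≤s z≤n) (minDeg u u∈C))
    ... | w , w∈C , uw = w , ∈-─⁺ w∈C (adj-irrefl uw ∘ sym)

  frame-move : ∀ {d S X C a} → Frame d S X C → a ∈ˢ C ∩ N[ X ] → HasCore d (C ─ a) →
               Frame d S (X ∪ ⁅ a ⁆) (C ─ a)
  frame-move {d} {X = X} {C} {a} F a∈ core = record
    { X⊆S     = ∪-⊆ X⊆S (⁅⁆-⊆ (C⊆S a (∈-∩⁻ˡ a∈)))
    ; C⊆S     = λ v → C⊆S v ∘ ─-⊆ v
    ; X≠∅     = proj₁ X≠∅ , ∈-∪⁺ˡ (proj₂ X≠∅)
    ; X-conn  = connected-∪ X-conn (⁅⁆-⊆ (∈-∩⁻ʳ a∈))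
    ; X∩C=∅   = disjoint
    ; C-core  = core
    ; far-deg = far
    }
    where
    open Frame F
    disjoint : Disjoint (X ∪ ⁅ a ⁆) (C ─ a)
    disjoint v v∈ v∈C─a with ∈-∪⁻ v∈
    ... | inj₁ v∈X = X∩C=∅ v v∈X (─-⊆ v v∈C─a)
    ... | inj₂ v∈a = ∈-─⁻ʳ v∈C─a (∈-⁅⁆⁻ v∈a)
    far : ∀ v → v ∈ˢ C ─ a → N[ X ∪ ⁅ a ⁆ ] v ≡ false → suc d ≤ deg (C ─ a) v
    far v v∈ v∉N =
      subst (suc d ≤_) (sym (deg-remove-nonadj C (trans (Graph.sym G v a) (∉N v∉N (∈-∪⁺ʳ ∈-⁅⁆)))))
            (far-deg v (─-⊆ v v∈) (⊆-∉ (N-mono (λ _ → ∈-∪⁺ˡ)) v∉N))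

  frame-settle : ∀ {d S X C} → CriticalCover d → Frame d S X C → Acc _<_ (count C) →
                 ∃ λ X′ → ∃ λ C′ → Frame d S X′ C′ × C′ ⊆ N[ X′ ]
  frame-settle {d} {X = X} {C} cover F (acc rec) with nonEmpty? (C ∩ N[ X ])
  ... | yes near with any? (λ a → ((C ∩ N[ X ]) a ≟ᵇ true) ×-dec hasCore? d (C ─ a))
  ...   | yes (a , a∈ , core) =
    frame-settle cover (frame-move F a∈ core) (rec (count-─< {S = C} (∈-∩⁻ˡ a∈)))
  ...   | no noMove =
    X , C , F , cover C N[ X ] C-core near far-deg (λ a a∈ core → noMove (a , a∈ , core))
    where open Frame F
  frame-settle {d} {X = X} {C} cover F (acc rec) | no none with hasCore⇒nonEmpty (Frame.C-core F)
  ... | u , u∈C =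
    frame-settle cover (frame-restart (Frame.C⊆S F) minDeg u∈C) (rec (count-─< {S = C} u∈C))
    where
    minDeg : MinDegree (suc d) C
    minDeg v v∈C = Frame.far-deg F v v∈C (trans (sym (∩-∈ˡ v∈C)) (¬nonEmpty⇒empty none v))

  core⇒model-suc : ∀ {d} → (∀ T → HasCore d T → ModelIn (suc d) T) → CriticalCover d →
                   ∀ S → HasCore (suc d) S → ModelIn (suc (suc d)) S
  core⇒model-suc model cover S (K , K⊆S , (x , x∈K) , minDeg)
    with frame-settle cover (frame-restart (λ _ → id) minDeg x∈K) (<-wellFounded _)
  ... | X , C , F , C⊆N =
    modelIn-mono (λ v → K⊆S v ∘ ∪-⊆ X⊆S C⊆S v) (extendModel X≠∅ X-conn X∩C=∅ C⊆N (model C C-core))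
    where open Frame F

  core₀⇒model : ∀ T → HasCore 0 T → ModelIn 1 T
  core₀⇒model T core = singletonModel (proj₂ (hasCore⇒nonEmpty core))

  core₃⇒model : ∀ S → HasCore 3 S → ModelIn 4 S
  core₃⇒model =
    core⇒model-suc (core⇒model-suc (core⇒model-suc core₀⇒model criticalCover₀) criticalCover₁) criticalCover₂

  -- Colourings

  Proper : ∀ {A : Set} → VSet n → (Fin n → A) → Set
  Proper S c = ∀ u v → u ∈ˢ S → v ∈ˢ S → Adj G u v → c u ≢ c v

  ColourableOn : VSet n → ℕ → Set
  ColourableOn S k = Σ (Fin n → Fin k) (Proper S)

  proper-∘ : ∀ {A B : Set} {S} {c : Fin n → A} {f : A → B} →
             Injective _≡_ _≡_ f → Proper S c → Proper S (f ∘ c)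
  proper-∘ f-inj proper u v u∈ v∈ uv = proper u v u∈ v∈ uv ∘ f-inj

  proper-updateAt : ∀ {A : Set} {T v} {c : Fin n → A} {x} → Proper (T ─ v) c →
                    (∀ u → u ∈ˢ T → Adj G v u → c u ≢ x) → Proper T (updateAt c v (λ _ → x))
  proper-updateAt {v = v} {c} {x} proper free u w u∈ w∈ uw with u ≟ v | w ≟ v
  ... | yes refl | yes refl = ⊥-elim (adj-irrefl uw refl)
  ... | yes refl | no w≢v
    rewrite updateAt-updates v {λ _ → x} c | updateAt-minimal w v {λ _ → x} c w≢v = free w w∈ uw ∘ sym
  ... | no u≢v | yes refl
    rewrite updateAt-updates v {λ _ → x} c | updateAt-minimal u v {λ _ → x} c u≢v = free u u∈ (adj-sym uw)
  ... | no u≢v | no w≢v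
    rewrite updateAt-minimal u v {λ _ → x} c u≢v | updateAt-minimal w v {λ _ → x} c w≢v =
    proper u w (∈-─⁺ u∈ u≢v) (∈-─⁺ w∈ w≢v) uw

  freeColour : ∀ {m} T v (c : Fin n → Fin m) → deg T v < m →
               ∃ λ i → ∀ u → u ∈ˢ T → Adj G v u → c u ≢ i
  freeColour {m} T v c low = choose (all? used?)
    where
    Used : Fin m → Set
    Used i = ∃ λ u → u ∈ˢ T ∩ adj G v × c u ≡ i
    used? : ∀ i → Dec (Used i)
    used? i = any? (λ u → ((T ∩ adj G v) u ≟ᵇ true) ×-dec (c u ≟ i))
    choose : Dec (∀ i → Used i) → ∃ λ i → ∀ u → u ∈ˢ T → Adj G v u → c u ≢ i
    choose (yes allUsed) = ⊥-elim (<⇒≱ low (injection⇒≤count {S = T ∩ adj G v} witness witness-injective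
                                                (proj₁ ∘ proj₂ ∘ allUsed)))
      where
      witness : Fin m → Fin n
      witness = proj₁ ∘ allUsed
      witness-injective : Injective _≡_ _≡_ witness
      witness-injective {i} {j} eq =
        trans (sym (proj₂ (proj₂ (allUsed i)))) (trans (cong c eq) (proj₂ (proj₂ (allUsed j))))
    choose (no ¬allUsed) with ¬∀⟶∃¬ m Used used? ¬allUsed
    ... | i , unused = i , λ u u∈T vu cu≡i → unused (u , ∈-∩⁺ u∈T vu , cu≡i)

  noCore⇒colourable : ∀ k S → ¬ HasCore (suc k) S → ColourableOn S (suc k)
  noCore⇒colourable k = noCore-induction (suc k) (λ S → ColourableOn S (suc k)) empty extend
    where
    empty : ∀ {S} → Empty S → ColourableOn S (suc k)
    empty {S} S=∅ = (λ _ → zero) , λ u _ u∈ → ⊥-elim (∉-≢ S (S=∅ u) u∈ refl)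
    extend : ∀ {T v} → v ∈ˢ T → deg T v < suc k → ColourableOn (T ─ v) (suc k) → ColourableOn T (suc k)
    extend {T} {v} _ low (c , proper) with freeColour T v c low
    ... | i , free = updateAt c v (λ _ → i) , proper-updateAt proper free

  paletteIndex : Bool → Fin 2
  paletteIndex false = zero
  paletteIndex true  = suc zero

  paletteIndex-injective : Injective _≡_ _≡_ paletteIndex
  paletteIndex-injective {false} {false} _ = refl
  paletteIndex-injective {true}  {true}  _ = refl

  twoPalettes : ∀ {k} → Bool × Fin k → Fin (2 * k)
  twoPalettes (p , i) = combine (paletteIndex p) i

  twoPalettes-injective : ∀ {k} → Injective _≡_ _≡_ (twoPalettes {k})
  twoPalettes-injective {x = p , i} {q , j} eq with combine-injective (paletteIndex p) i (paletteIndex q) j eq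
  ... | p≡q , refl = cong (_, i) (paletteIndex-injective p≡q)

  palettes-differ : ∀ {A : Set} {x y : Bool × A} {p q} → proj₁ x ≡ p → proj₁ y ≡ q → p ≢ q → x ≢ y
  palettes-differ x∈p y∈q p≢q x≡y = p≢q (trans (sym x∈p) (trans (cong proj₁ x≡y) y∈q))

  proper-glue : ∀ {A : Set} {R P} {c₁ c₂ : Fin n → Bool × A} q →
                Proper (R ∩ P) c₁ → (∀ v → v ∈ˢ R ∩ P → proj₁ (c₁ v) ≡ q) →
                Proper (R ∖ P) c₂ → (∀ v → v ∈ˢ R ∖ P → v ∈ˢ N[ R ∩ P ] → proj₁ (c₂ v) ≡ not q) →
                Proper R (λ v → if P v then c₁ v else c₂ v)
  proper-glue {R = R} {P} q proper₁ palette₁ proper₂ palette₂ u w u∈ w∈ uw with P u in u∈P | P w in w∈P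
  ... | true  | true  = proper₁ u w (∈-∩⁺ u∈ u∈P) (∈-∩⁺ w∈ w∈P) uw
  ... | true  | false =
    palettes-differ (palette₁ u u∈R∩P) (palette₂ w (∈-∖⁺ w∈ w∈P) (∈N⁺ u∈R∩P uw)) (not-¬ refl)
    where
    u∈R∩P : u ∈ˢ R ∩ P
    u∈R∩P = ∈-∩⁺ u∈ u∈P
  ... | false | true  =
    palettes-differ (palette₂ u (∈-∖⁺ u∈ u∈P) (∈N⁺ w∈R∩P (adj-sym uw))) (palette₁ w w∈R∩P) (not-¬ refl ∘ sym)
    where
    w∈R∩P : w ∈ˢ R ∩ P
    w∈R∩P = ∈-∩⁺ w∈ w∈P
  ... | false | false = proper₂ u w (∈-∖⁺ u∈ u∈P) (∈-∖⁺ w∈ w∈P) uw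

  layer-disjoint : ∀ {X R} → Disjoint X R → Disjoint (X ∪ R ∩ N[ X ]) (R ∖ N[ X ])
  layer-disjoint {X} X∩R=∅ v v∈ v∈R∖N with ∈-∪⁻ v∈
  ... | inj₁ v∈X = X∩R=∅ v v∈X (∈-∖⁻ˡ v∈R∖N)
  ... | inj₂ v∈L = ∉-≢ N[ X ] (∈-∖⁻ʳ v∈R∖N) (∈-∩⁻ʳ v∈L) refl

  layer-⊆ : ∀ {X R} → (X ∪ R ∩ N[ X ]) ∪ R ∖ N[ X ] ⊆ X ∪ R
  layer-⊆ = ∪-⊆ (∪-⊆ (λ _ → ∈-∪⁺ˡ) (λ _ → ∈-∪⁺ʳ ∘ ∈-∩⁻ˡ)) (λ _ → ∈-∪⁺ʳ ∘ ∈-∖⁻ˡ)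

  module Layering {t k : ℕ} (colour : ∀ R → NoModel (suc t) R → ColourableOn R k) where

    -- Supplies colours where any colour will do: at the root of a component and outside the
    -- coloured set.
    c₀ : Fin n → Fin k
    c₀ = proj₁ (colour ∅ noModel-∅)

    ColouringAway : VSet n → VSet n → Bool → Set
    ColouringAway X R q =
      Σ (Fin n → Bool × Fin k) λ c → Proper R c × (∀ v → v ∈ˢ R ∩ N[ X ] → proj₁ (c v) ≡ q)

    layerColouring : ∀ {X R q} → NoModel (suc (suc t)) (X ∪ R) → Connected G X → Disjoint X R →
                     NonEmpty (R ∩ N[ X ]) → ColouringAway (X ∪ R ∩ N[ X ]) (R ∖ N[ X ]) (not q) →
                     ColouringAway X R q
    layerColouring {X} {R} {q} noModel X-conn X∩R=∅ (a , a∈) (cB , properB , paletteB) =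
      c , proper , palette
      where
      X≠∅ : NonEmpty X
      X≠∅ = let (x , x∈X , _) = ∈N⁻ (∈-∩⁻ʳ a∈) in x , x∈X
      noModelL : NoModel (suc t) (R ∩ N[ X ])
      noModelL = noModel ∘ modelIn-mono (∪-⊆ (λ _ → ∈-∪⁺ˡ) (λ _ → ∈-∪⁺ʳ ∘ ∈-∩⁻ˡ))
                         ∘ extendModel X≠∅ X-conn (λ v v∈X → X∩R=∅ v v∈X ∘ ∈-∩⁻ˡ) (λ _ → ∈-∩⁻ʳ)
      cL : Fin n → Fin k
      cL = proj₁ (colour (R ∩ N[ X ]) noModelL)
      c : Fin n → Bool × Fin k
      c v = if N[ X ] v then (q , cL v) else cB v
      proper : Proper R c
      proper = proper-glue q (proper-∘ ,-injectiveʳ (proj₂ (colour (R ∩ N[ X ]) noModelL)))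
                 (λ _ _ → refl) properB
                 (λ v v∈ v∈N → paletteB v (∈-∩⁺ v∈ (N-mono (λ _ → ∈-∪⁺ʳ) v v∈N)))
      palette : ∀ v → v ∈ˢ R ∩ N[ X ] → proj₁ (c v) ≡ q
      palette v v∈ rewrite ∈-∩⁻ʳ {S = R} v∈ = refl

    rootColouring : ∀ {X R q r} → ¬ NonEmpty (R ∩ N[ X ]) → r ∈ˢ R →
                    ColouringAway ⁅ r ⁆ (R ─ r) false → ColouringAway X R q
    rootColouring {R = R} {r = r} noLayer r∈R (cB , properB , paletteB) =
      c , proper , λ v v∈ → ⊥-elim (noLayer (v , v∈))
      where
      c : Fin n → Bool × Fin k
      c v = if ⁅ r ⁆ v then (true , c₀ r) else cB v
      properRoot : Proper (R ∩ ⁅ r ⁆) (λ _ → true , c₀ r)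
      properRoot u w u∈ w∈ uw =
        ⊥-elim (adj-irrefl uw (trans (∈-⁅⁆⁻ (∈-∩⁻ʳ u∈)) (sym (∈-⁅⁆⁻ (∈-∩⁻ʳ w∈)))))
      proper : Proper R c
      proper = proper-glue true properRoot (λ _ _ → refl) properB
                 (λ v v∈ v∈N → paletteB v (∈-∩⁺ v∈ (N-mono (λ _ → ∈-∩⁻ʳ) v v∈N)))

    colourAway : ∀ X R → Acc _<_ (count R) → ∀ q → Connected G X → Disjoint X R →
                 NoModel (suc (suc t)) (X ∪ R) → ColouringAway X R q
    colourAway X R (acc rec) q X-conn X∩R=∅ noModel with nonEmpty? (R ∩ N[ X ]) | nonEmpty? R
    ... | yes (a , a∈) | _ =
      layerColouring noModel X-conn X∩R=∅ (a , a∈)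
        (colourAway (X ∪ R ∩ N[ X ]) (R ∖ N[ X ]) (rec (count-∖< a∈)) (not q)
          (connected-∪ X-conn (λ _ → ∈-∩⁻ʳ)) (layer-disjoint X∩R=∅) (noModel ∘ modelIn-mono layer-⊆))
    ... | no noLayer | yes (r , r∈R) =
      rootColouring noLayer r∈R
        (colourAway ⁅ r ⁆ (R ─ r) (rec (count-─< {S = R} r∈R)) false (connected-⁅⁆ r)
          (λ v v∈r v∈R─r → ∈-─⁻ʳ v∈R─r (∈-⁅⁆⁻ v∈r))
          (noModel ∘ modelIn-mono (∪-⊆ (⁅⁆-⊆ (∈-∪⁺ʳ r∈R)) (λ v → ∈-∪⁺ʳ ∘ ─-⊆ v))))
    ... | no noLayer | no R=∅ =
      (λ v → q , c₀ v) , (λ u _ u∈R → ⊥-elim (R=∅ (u , u∈R))) , (λ v v∈ → ⊥-elim (noLayer (v , v∈)))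

    doubling : ∀ S → NoModel (suc (suc t)) S → ColourableOn S (2 * k)
    doubling S noModel
      with colourAway ∅ S (<-wellFounded _) true connected-∅ (λ _ ())
                      (noModel ∘ modelIn-mono (∪-⊆ (λ _ ()) (λ _ → id)))
    ... | c , proper , _ = twoPalettes ∘ c , proper-∘ twoPalettes-injective proper

  noModel⇒colourable : ∀ m S → NoModel (4 + m) S → ColourableOn S (3 * 2 ^ m)
  noModel⇒colourable zero    S noModel = noCore⇒colourable 2 S (noModel ∘ core₃⇒model S)
  noModel⇒colourable (suc m) S noModel =
    subst (ColourableOn S) (x∙yz≈y∙xz *-commutativeSemigroup 2 3 (2 ^ m))
          (Layering.doubling (noModel⇒colourable m) S noModel)

theorem22 : (t : ℕ) → 4 ≤ t → (n : ℕ) → (G : Graph n) →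
    ¬ DominatingModel G t → Colourable G (3 * 2 ^ (t ∸ 4))
theorem22 (suc (suc (suc (suc m)))) (s≤s (s≤s (s≤s (s≤s z≤n)))) n G noModel
  with noModel⇒colourable G m (λ _ → true) (noModel ∘ proj₁)
... | c , proper = c , λ u v uv → proper u v refl refl uv
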